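{- For all integers $n,m,p\ge0$, \[ \mathcal{Z}_{n+1,m}(p)=\frac{m+1}{m+p+1}\mathcal{Z}_{n,m+1}(p)+m\,\mathcal{Z}_{n,m}(p), \] and $\mathcal{Z}_{0,m}(p)=1$ for all $m\ge0$.
   Context: $s(m,k)$ are the signed Stirling numbers of the first kind, $x(x-1)\cdots(x-m+1)=\sum_{k=0}^m s(m,k)x^k$. For an integer $p\ge0$, the $p$-Bell numbers $\mathcal{B}_{n,p}$ are defined by $\sum_{n\geq0}\mathcal{B}_{n,p}\frac{z^{n}}{n!}=\sum_{k\geq0}\binom{k+p}{p}^{ -1}\frac{(e^{z}-1)^{k}}{k!}$. Define $\mathcal{Z}_{n,m}(p)=\binom{m+p}{p}\sum_{k=0}^{m}s(m,k)\mathcal{B}_{n+k,p}$ for $n,m\ge0$ (so $\mathcal{Z}_{n,0}(p)=\mathcal{B}_{n,p}$). -}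

module Defs where

open import Data.Nat as ℕ using (ℕ; zero; suc; _<_; z<s)
open import Data.Nat.Properties using (+-comm; ≤-trans; m≤m+n)
open import Data.Nat.Combinatorics using (_C_; nCk+nC[k+1]≡[n+1]C[k+1])
open import Data.Integer as ℤ using (ℤ; +_)
open import Data.Rational as ℚ using (ℚ; 0ℚ; _+_; _*_; _/_)
open import Relation.Binary.PropositionalEquality using (_≡_; subst; sym)

sumTo : ℕ → (ℕ → ℚ) → ℚ
sumTo zero    f = f 0
sumTo (suc n) f = sumTo n f + f (suc n)

-- SIGNED Stirling numbers of the first kind s(m,k),
-- via the recurrence coming from x(x-1)...(x-m) = (x(x-1)...(x-m+1))(x - m):
-- s(0,0)=1, s(0,k+1)=0, s(m+1,0)=0, s(m+1,k+1)=s(m,k) - m s(m,k+1).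
stirling1 : ℕ → ℕ → ℤ
stirling1 zero    zero    = + 1
stirling1 zero    (suc k) = + 0
stirling1 (suc m) zero    = + 0
stirling1 (suc m) (suc k) = stirling1 m k ℤ.- (+ m) ℤ.* stirling1 m (suc k)

stirling2 : ℕ → ℕ → ℕ
stirling2 zero    zero    = 1
stirling2 zero    (suc k) = 0
stirling2 (suc n) zero    = 0
stirling2 (suc n) (suc k) = suc k ℕ.* stirling2 n (suc k) ℕ.+ stirling2 n k

binomPos' : ∀ p k → 0 < (p ℕ.+ k) C p
binomPos' zero k = z<s
binomPos' (suc p) k =
  subst (0 <_) (nCk+nC[k+1]≡[n+1]C[k+1] (p ℕ.+ k) p)
        (≤-trans (binomPos' p k) (m≤m+n _ _))

binomPos : ∀ k p → 0 < (k ℕ.+ p) C p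
binomPos k p = subst (λ x → 0 < x C p) (+-comm p k) (binomPos' p k)

invBinom : ℕ → ℕ → ℚ
invBinom k p = ((+ 1) / ((k ℕ.+ p) C p)) {{ℕ.>-nonZero (binomPos k p)}}

-- p-Bell numbers: coefficient extraction from
--   Σ_n B_{n,p} z^n/n! = Σ_k C(k+p,p)^{-1} (e^z-1)^k/k!,
-- i.e. B_{n,p} = Σ_{k=0}^{n} S(n,k) / C(k+p,p)  (S(n,k)=0 for k>n).
pBell : ℕ → ℕ → ℚ
pBell n p = sumTo n (λ k → ((+ stirling2 n k) / 1) * invBinom k p)

Z : ℕ → ℕ → ℕ → ℚ
Z n m p = ((+ ((m ℕ.+ p) C p)) / 1)
          * sumTo m (λ k → (stirling1 m k / 1) * pBell (n ℕ.+ k) p)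

{-# OPTIONS --safe #-}
module Submission where

open import Defs
open import Data.Nat using (ℕ; suc; _+_)
open import Data.Integer using (+_)
open import Data.Rational using (ℚ; 1ℚ; _/_; _*_) renaming (_+_ to _+ℚ_)
open import Data.Product using (_×_)
open import Relation.Binary.PropositionalEquality using (_≡_)

open import Algebra.Bundles using (CommutativeMonoid)
import Algebra.Properties.CommutativeSemigroup as CommSemigroupProperties
import Algebra.Properties.Group as GroupProperties
open import Data.List using (_∷_; [])
open import Data.Nat as ℕ using (zero; z<s; s<s)
import Data.Nat.Properties as ℕₚ
open import Data.Nat.Combinatorics using (_C_; nCk+nC[k+1]≡[n+1]C[k+1]; nC1≡n; nCk≡nC[n∸k]; k>n⇒nCk≡0)
open import Data.Nat.Tactic.RingSolver using () renaming (solve-∀ to ℕ-solve-∀)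
open import Data.Integer as ℤ using (ℤ; 0ℤ)
import Data.Integer.Properties as ℤₚ
open import Data.Integer.Tactic.RingSolver using () renaming (solve to ℤ-solve; solve-∀ to ℤ-solve-∀)
open import Data.Rational using (0ℚ; fromℚᵘ; toℚᵘ)
import Data.Rational.Properties as ℚₚ
open import Data.Rational.Unnormalised as ℚᵘ using (mkℚᵘ; *≡*)
import Data.Rational.Unnormalised.Properties as ℚᵘₚ
open import Data.Product using (_,_)
open import Relation.Binary.PropositionalEquality using (refl; sym; trans; cong; cong₂; module ≡-Reasoning)

open GroupProperties ℚₚ.+-0-group using () renaming (∙-cancelʳ to +-cancelʳ)
open CommSemigroupProperties (CommutativeMonoid.commutativeSemigroup ℚₚ.+-0-commutativeMonoid)
  using () renaming (interchange to +-interchange)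
open CommSemigroupProperties (CommutativeMonoid.commutativeSemigroup ℚₚ.*-1-commutativeMonoid)
  using () renaming (x∙yz≈y∙xz to *-x∙yz≈y∙xz; xy∙z≈y∙xz to *-xy∙z≈y∙xz)

-- Reading x^k as B_{n+k,p}, the shift n ↦ n+1 is multiplication by x, so the recurrence is the
-- falling-factorial identity x (x)_m = (x)_{m+1} + m (x)_m, which holds for the Stirling transform
-- Σ_k s(m,k) f(k) of an arbitrary sequence f; the binomial prefactors match because
-- (m+1) C(m+1+p,p) = (m+p+1) C(m+p,p).
-- For n = 0, B_{k,p} = Σ_j S(k,j) b_j with b_j = 1/C(j+p,p), and Stirling inversion
-- Σ_k s(m,k) Σ_j S(k,j) b_j = b_m gives Z_{0,m}(p) = C(m+p,p) b_m = 1. The inversion is proved by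
-- induction on m for all sequences b at once, since the S-transform turns n ↦ n+1 into
-- b_j ↦ b_{j+1} + j b_j.

fromℚᵘ-homo-+ : ∀ p q → fromℚᵘ (p ℚᵘ.+ q) ≡ fromℚᵘ p +ℚ fromℚᵘ q
fromℚᵘ-homo-+ p q = ℚₚ.toℚᵘ-injective (begin
    toℚᵘ (fromℚᵘ (p ℚᵘ.+ q))                 ≈⟨ ℚₚ.toℚᵘ-fromℚᵘ (p ℚᵘ.+ q) ⟩
    p ℚᵘ.+ q                                  ≈⟨ ℚᵘₚ.+-cong (ℚₚ.toℚᵘ-fromℚᵘ p) (ℚₚ.toℚᵘ-fromℚᵘ q) ⟨
    toℚᵘ (fromℚᵘ p) ℚᵘ.+ toℚᵘ (fromℚᵘ q)      ≈⟨ ℚₚ.toℚᵘ-homo-+ (fromℚᵘ p) (fromℚᵘ q) ⟨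
    toℚᵘ (fromℚᵘ p +ℚ fromℚᵘ q)               ∎)
  where open ℚᵘₚ.≃-Reasoning

fromℚᵘ-homo-* : ∀ p q → fromℚᵘ (p ℚᵘ.* q) ≡ fromℚᵘ p * fromℚᵘ q
fromℚᵘ-homo-* p q = ℚₚ.toℚᵘ-injective (begin
    toℚᵘ (fromℚᵘ (p ℚᵘ.* q))                 ≈⟨ ℚₚ.toℚᵘ-fromℚᵘ (p ℚᵘ.* q) ⟩
    p ℚᵘ.* q                                  ≈⟨ ℚᵘₚ.*-cong (ℚₚ.toℚᵘ-fromℚᵘ p) (ℚₚ.toℚᵘ-fromℚᵘ q) ⟨
    toℚᵘ (fromℚᵘ p) ℚᵘ.* toℚᵘ (fromℚᵘ q)      ≈⟨ ℚₚ.toℚᵘ-homo-* (fromℚᵘ p) (fromℚᵘ q) ⟨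
    toℚᵘ (fromℚᵘ p * fromℚᵘ q)                ∎)
  where open ℚᵘₚ.≃-Reasoning

-- Definitionally fromℤ i = fromℚᵘ (mkℚᵘ i 0); its homomorphism laws are transported from ℚᵘ.
fromℤ : ℤ → ℚ
fromℤ i = i / 1

fromℤ-homo-+ : ∀ i j → fromℤ (i ℤ.+ j) ≡ fromℤ i +ℚ fromℤ j
fromℤ-homo-+ i j = trans (ℚₚ.fromℚᵘ-cong {mkℚᵘ (i ℤ.+ j) 0} {mkℚᵘ i 0 ℚᵘ.+ mkℚᵘ j 0} (*≡* cross))
  (fromℚᵘ-homo-+ (mkℚᵘ i 0) (mkℚᵘ j 0))
  where
  cross : (i ℤ.+ j) ℤ.* + 1 ≡ (i ℤ.* + 1 ℤ.+ j ℤ.* + 1) ℤ.* + 1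
  cross = ℤ-solve (i ∷ j ∷ [])

fromℤ-homo-* : ∀ i j → fromℤ (i ℤ.* j) ≡ fromℤ i * fromℤ j
fromℤ-homo-* i j = trans (ℚₚ.fromℚᵘ-cong {mkℚᵘ (i ℤ.* j) 0} {mkℚᵘ i 0 ℚᵘ.* mkℚᵘ j 0} (*≡* refl))
  (fromℚᵘ-homo-* (mkℚᵘ i 0) (mkℚᵘ j 0))

/-*-fromℤ : ∀ a b c d .{{_ : ℕ.NonZero d}} → a ℤ.* b ≡ c ℤ.* + d → (a / d) * fromℤ b ≡ fromℤ c
/-*-fromℤ a b c (suc d) ab≡cd =
  trans (sym (fromℚᵘ-homo-* (mkℚᵘ a d) (mkℚᵘ b 0)))
        (ℚₚ.fromℚᵘ-cong {mkℚᵘ a d ℚᵘ.* mkℚᵘ b 0} {mkℚᵘ c 0} (*≡* cross))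
  where
  cross : (a ℤ.* b) ℤ.* + 1 ≡ c ℤ.* + (suc d ℕ.* 1)
  cross = trans (ℤₚ.*-identityʳ (a ℤ.* b))
                (trans ab≡cd (cong (λ e → c ℤ.* + e) (sym (ℕₚ.*-identityʳ (suc d)))))

sumTo-cong : ∀ n {f g : ℕ → ℚ} → (∀ k → f k ≡ g k) → sumTo n f ≡ sumTo n g
sumTo-cong zero    f≗g = f≗g 0
sumTo-cong (suc n) f≗g = cong₂ _+ℚ_ (sumTo-cong n f≗g) (f≗g (suc n))

sumTo-distrib-+ : ∀ n (f g : ℕ → ℚ) → sumTo n (λ k → f k +ℚ g k) ≡ sumTo n f +ℚ sumTo n g
sumTo-distrib-+ zero    f g = refl
sumTo-distrib-+ (suc n) f g = trans (cong (_+ℚ (f (suc n) +ℚ g (suc n))) (sumTo-distrib-+ n f g))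
  (+-interchange (sumTo n f) (sumTo n g) (f (suc n)) (g (suc n)))

*-distribˡ-sumTo : ∀ n c (f : ℕ → ℚ) → c * sumTo n f ≡ sumTo n (λ k → c * f k)
*-distribˡ-sumTo zero    c f = refl
*-distribˡ-sumTo (suc n) c f =
  trans (ℚₚ.*-distribˡ-+ c (sumTo n f) (f (suc n))) (cong (_+ℚ c * f (suc n)) (*-distribˡ-sumTo n c f))

sumTo-dropHead : ∀ n (f : ℕ → ℚ) → f 0 ≡ 0ℚ → sumTo (suc n) f ≡ sumTo n (λ k → f (suc k))
sumTo-dropHead zero    f f0≡0 = trans (cong (_+ℚ f 1) f0≡0) (ℚₚ.+-identityˡ (f 1))
sumTo-dropHead (suc n) f f0≡0 = cong (_+ℚ f (suc (suc n))) (sumTo-dropHead n f f0≡0)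

sumTo-shift : ∀ n (f : ℕ → ℚ) → f 0 ≡ 0ℚ → f (suc n) ≡ 0ℚ → sumTo n (λ k → f (suc k)) ≡ sumTo n f
sumTo-shift n f f0≡0 f[1+n]≡0 = begin
  sumTo n (λ k → f (suc k))  ≡⟨ sumTo-dropHead n f f0≡0 ⟨
  sumTo n f +ℚ f (suc n)     ≡⟨ cong (sumTo n f +ℚ_) f[1+n]≡0 ⟩
  sumTo n f +ℚ 0ℚ            ≡⟨ ℚₚ.+-identityʳ (sumTo n f) ⟩
  sumTo n f                  ∎
  where open ≡-Reasoning

stirling1Sum : ℕ → (ℕ → ℚ) → ℚ
stirling1Sum m f = sumTo m (λ k → fromℤ (stirling1 m k) * f k)

stirling2Sum : (ℕ → ℚ) → ℕ → ℚ
stirling2Sum b n = sumTo n (λ k → fromℤ (+ stirling2 n k) * b k)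

stirling1Sum-cong : ∀ m {f g : ℕ → ℚ} → (∀ k → f k ≡ g k) → stirling1Sum m f ≡ stirling1Sum m g
stirling1Sum-cong m f≗g = sumTo-cong m (λ k → cong (fromℤ (stirling1 m k) *_) (f≗g k))

k>m⇒stirling1[m,k]≡0 : ∀ {m k} → k ℕ.> m → stirling1 m k ≡ 0ℤ
k>m⇒stirling1[m,k]≡0 {zero}  {suc k} _         = refl
k>m⇒stirling1[m,k]≡0 {suc m} {suc k} (s<s m<k)
  rewrite k>m⇒stirling1[m,k]≡0 m<k | k>m⇒stirling1[m,k]≡0 (ℕₚ.m<n⇒m<1+n m<k) | ℤₚ.*-zeroʳ (+ m) = refl

k>n⇒stirling2[n,k]≡0 : ∀ {n k} → k ℕ.> n → stirling2 n k ≡ 0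
k>n⇒stirling2[n,k]≡0 {zero}  {suc k} _         = refl
k>n⇒stirling2[n,k]≡0 {suc n} {suc k} (s<s n<k)
  rewrite k>n⇒stirling2[n,k]≡0 n<k | k>n⇒stirling2[n,k]≡0 (ℕₚ.m<n⇒m<1+n n<k) | ℕₚ.*-zeroʳ k = refl

m*stirling1[m,0]≡0 : ∀ m → + m ℤ.* stirling1 m 0 ≡ 0ℤ
m*stirling1[m,0]≡0 zero    = refl
m*stirling1[m,0]≡0 (suc m) = ℤₚ.*-zeroʳ (+ suc m)

stirling1-rec : ∀ m k → stirling1 m k ≡ stirling1 (suc m) (suc k) ℤ.+ + m ℤ.* stirling1 m (suc k)
stirling1-rec m k = i≡i-j+j (stirling1 m k) (+ m ℤ.* stirling1 m (suc k))
  where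
  i≡i-j+j : ∀ i j → i ≡ i ℤ.- j ℤ.+ j
  i≡i-j+j = ℤ-solve-∀

stirling1Sum-shift : ∀ m (f : ℕ → ℚ) →
  stirling1Sum m (λ k → f (suc k)) ≡ stirling1Sum (suc m) f +ℚ fromℤ (+ m) * stirling1Sum m f
stirling1Sum-shift m f = begin
  stirling1Sum m (λ k → f (suc k))
    ≡⟨ sumTo-cong m split ⟩
  sumTo m (λ k → next (suc k) +ℚ scaled (suc k))
    ≡⟨ sumTo-distrib-+ m (λ k → next (suc k)) (λ k → scaled (suc k)) ⟩
  sumTo m (λ k → next (suc k)) +ℚ sumTo m (λ k → scaled (suc k))
    ≡⟨ cong₂ _+ℚ_ (sym (sumTo-dropHead m next (ℚₚ.*-zeroˡ (f 0))))
                  (sumTo-shift m scaled scaled-0 scaled-end) ⟩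
  stirling1Sum (suc m) f +ℚ sumTo m scaled
    ≡⟨ cong (stirling1Sum (suc m) f +ℚ_) (sumTo-cong m scaled≡m*) ⟩
  stirling1Sum (suc m) f +ℚ sumTo m (λ k → fromℤ (+ m) * (fromℤ (stirling1 m k) * f k))
    ≡⟨ cong (stirling1Sum (suc m) f +ℚ_) (*-distribˡ-sumTo m (fromℤ (+ m)) _) ⟨
  stirling1Sum (suc m) f +ℚ fromℤ (+ m) * stirling1Sum m f
    ∎
  where
  open ≡-Reasoning
  next scaled : ℕ → ℚ
  next   k = fromℤ (stirling1 (suc m) k) * f k
  scaled k = fromℤ (+ m ℤ.* stirling1 m k) * f k

  split : ∀ k → fromℤ (stirling1 m k) * f (suc k) ≡ next (suc k) +ℚ scaled (suc k)
  split k = begin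
    fromℤ (stirling1 m k) * f (suc k)
      ≡⟨ cong (λ i → fromℤ i * f (suc k)) (stirling1-rec m k) ⟩
    fromℤ (stirling1 (suc m) (suc k) ℤ.+ + m ℤ.* stirling1 m (suc k)) * f (suc k)
      ≡⟨ cong (_* f (suc k)) (fromℤ-homo-+ (stirling1 (suc m) (suc k)) (+ m ℤ.* stirling1 m (suc k))) ⟩
    (fromℤ (stirling1 (suc m) (suc k)) +ℚ fromℤ (+ m ℤ.* stirling1 m (suc k))) * f (suc k)
      ≡⟨ ℚₚ.*-distribʳ-+ (f (suc k)) (fromℤ (stirling1 (suc m) (suc k))) (fromℤ (+ m ℤ.* stirling1 m (suc k))) ⟩
    next (suc k) +ℚ scaled (suc k)
      ∎

  vanishing : ∀ {k} → + m ℤ.* stirling1 m k ≡ 0ℤ → scaled k ≡ 0ℚ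
  vanishing {k} m*s≡0 = trans (cong (λ i → fromℤ i * f k) m*s≡0) (ℚₚ.*-zeroˡ (f k))

  scaled-0 : scaled 0 ≡ 0ℚ
  scaled-0 = vanishing (m*stirling1[m,0]≡0 m)

  scaled-end : scaled (suc m) ≡ 0ℚ
  scaled-end = vanishing (trans (cong (+ m ℤ.*_) (k>m⇒stirling1[m,k]≡0 (ℕₚ.n<1+n m))) (ℤₚ.*-zeroʳ (+ m)))

  scaled≡m* : ∀ k → scaled k ≡ fromℤ (+ m) * (fromℤ (stirling1 m k) * f k)
  scaled≡m* k = trans (cong (_* f k) (fromℤ-homo-* (+ m) (stirling1 m k)))
                      (ℚₚ.*-assoc (fromℤ (+ m)) (fromℤ (stirling1 m k)) (f k))

stirling2Sum-suc : ∀ (b : ℕ → ℚ) n →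
  stirling2Sum b (suc n) ≡ stirling2Sum (λ j → b (suc j) +ℚ fromℤ (+ j) * b j) n
stirling2Sum-suc b n = begin
  stirling2Sum b (suc n)
    ≡⟨ sumTo-dropHead n (λ j → fromℤ (+ stirling2 (suc n) j) * b j) (ℚₚ.*-zeroˡ (b 0)) ⟩
  sumTo n (λ j → fromℤ (+ stirling2 (suc n) (suc j)) * b (suc j))
    ≡⟨ sumTo-cong n split ⟩
  sumTo n (λ j → stay j +ℚ weighted (suc j))
    ≡⟨ sumTo-distrib-+ n stay (λ j → weighted (suc j)) ⟩
  sumTo n stay +ℚ sumTo n (λ j → weighted (suc j))
    ≡⟨ cong (sumTo n stay +ℚ_) (sumTo-shift n weighted weighted-0 weighted-end) ⟩
  sumTo n stay +ℚ sumTo n weighted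
    ≡⟨ sumTo-distrib-+ n stay weighted ⟨
  sumTo n (λ j → stay j +ℚ weighted j)
    ≡⟨ sumTo-cong n (λ j → ℚₚ.*-distribˡ-+ (fromℤ (+ stirling2 n j)) (b (suc j)) (fromℤ (+ j) * b j)) ⟨
  stirling2Sum (λ j → b (suc j) +ℚ fromℤ (+ j) * b j) n
    ∎
  where
  open ≡-Reasoning
  stay weighted : ℕ → ℚ
  stay     j = fromℤ (+ stirling2 n j) * b (suc j)
  weighted j = fromℤ (+ stirling2 n j) * (fromℤ (+ j) * b j)

  split : ∀ j → fromℤ (+ stirling2 (suc n) (suc j)) * b (suc j) ≡ stay j +ℚ weighted (suc j)
  split j = begin
    fromℤ (+ (suc j ℕ.* S₁ ℕ.+ S₀)) * b (suc j)
      ≡⟨ cong (λ i → fromℤ i * b (suc j)) (ℤₚ.pos-+ (suc j ℕ.* S₁) S₀) ⟩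
    fromℤ (+ (suc j ℕ.* S₁) ℤ.+ + S₀) * b (suc j)
      ≡⟨ cong (_* b (suc j)) (fromℤ-homo-+ (+ (suc j ℕ.* S₁)) (+ S₀)) ⟩
    (fromℤ (+ (suc j ℕ.* S₁)) +ℚ fromℤ (+ S₀)) * b (suc j)
      ≡⟨ cong (λ x → (x +ℚ fromℤ (+ S₀)) * b (suc j))
              (trans (cong fromℤ (ℤₚ.pos-* (suc j) S₁)) (fromℤ-homo-* (+ suc j) (+ S₁))) ⟩
    (fromℤ (+ suc j) * fromℤ (+ S₁) +ℚ fromℤ (+ S₀)) * b (suc j)
      ≡⟨ ℚₚ.*-distribʳ-+ (b (suc j)) (fromℤ (+ suc j) * fromℤ (+ S₁)) (fromℤ (+ S₀)) ⟩
    (fromℤ (+ suc j) * fromℤ (+ S₁)) * b (suc j) +ℚ stay j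
      ≡⟨ cong (_+ℚ stay j) (*-xy∙z≈y∙xz (fromℤ (+ suc j)) (fromℤ (+ S₁)) (b (suc j))) ⟩
    weighted (suc j) +ℚ stay j
      ≡⟨ ℚₚ.+-comm (weighted (suc j)) (stay j) ⟩
    stay j +ℚ weighted (suc j)
      ∎
    where
    S₀ = stirling2 n j
    S₁ = stirling2 n (suc j)

  weighted-0 : weighted 0 ≡ 0ℚ
  weighted-0 = trans (cong (fromℤ (+ stirling2 n 0) *_) (ℚₚ.*-zeroˡ (b 0)))
                     (ℚₚ.*-zeroʳ (fromℤ (+ stirling2 n 0)))

  weighted-end : weighted (suc n) ≡ 0ℚ
  weighted-end = trans (cong (λ s → fromℤ (+ s) * (fromℤ (+ suc n) * b (suc n)))
                             (k>n⇒stirling2[n,k]≡0 (ℕₚ.n<1+n n)))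
                       (ℚₚ.*-zeroˡ (fromℤ (+ suc n) * b (suc n)))

stirling-inversion : ∀ m (b : ℕ → ℚ) → stirling1Sum m (stirling2Sum b) ≡ b m
stirling-inversion zero    b = trans (ℚₚ.*-identityˡ (stirling2Sum b 0)) (ℚₚ.*-identityˡ (b 0))
stirling-inversion (suc m) b = +-cancelʳ (fromℤ (+ m) * b m) _ _ (begin
  stirling1Sum (suc m) (stirling2Sum b) +ℚ fromℤ (+ m) * b m
    ≡⟨ cong (λ x → stirling1Sum (suc m) (stirling2Sum b) +ℚ fromℤ (+ m) * x) (stirling-inversion m b) ⟨
  stirling1Sum (suc m) (stirling2Sum b) +ℚ fromℤ (+ m) * stirling1Sum m (stirling2Sum b)
    ≡⟨ stirling1Sum-shift m (stirling2Sum b) ⟨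
  stirling1Sum m (λ k → stirling2Sum b (suc k))
    ≡⟨ stirling1Sum-cong m (stirling2Sum-suc b) ⟩
  stirling1Sum m (stirling2Sum b′)
    ≡⟨ stirling-inversion m b′ ⟩
  b (suc m) +ℚ fromℤ (+ m) * b m
    ∎)
  where
  open ≡-Reasoning
  b′ : ℕ → ℚ
  b′ j = b (suc j) +ℚ fromℤ (+ j) * b j

[1+k]*[1+n]C[1+k]≡[1+n]*nCk : ∀ n k → suc k ℕ.* (suc n C suc k) ≡ suc n ℕ.* (n C k)
[1+k]*[1+n]C[1+k]≡[1+n]*nCk n zero = begin
  1 ℕ.* (suc n C 1)   ≡⟨ ℕₚ.*-identityˡ (suc n C 1) ⟩
  suc n C 1           ≡⟨ nC1≡n (suc n) ⟩
  suc n               ≡⟨ ℕₚ.*-identityʳ (suc n) ⟨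
  suc n ℕ.* (n C 0)   ∎
  where open ≡-Reasoning
[1+k]*[1+n]C[1+k]≡[1+n]*nCk zero (suc k)
  rewrite k>n⇒nCk≡0 {1} {suc (suc k)} (s<s z<s) | k>n⇒nCk≡0 {0} {suc k} z<s = ℕₚ.*-zeroʳ (suc (suc k))
[1+k]*[1+n]C[1+k]≡[1+n]*nCk (suc n) (suc k) = begin
  (2 ℕ.+ k) ℕ.* (suc (suc n) C suc (suc k))
    ≡⟨ cong ((2 ℕ.+ k) ℕ.*_) (nCk+nC[k+1]≡[n+1]C[k+1] (suc n) (suc k)) ⟨
  (2 ℕ.+ k) ℕ.* (A ℕ.+ B)
    ≡⟨ expand k A B ⟩
  A ℕ.+ (suc k ℕ.* A ℕ.+ suc (suc k) ℕ.* B)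
    ≡⟨ cong (A ℕ.+_) (cong₂ ℕ._+_ ([1+k]*[1+n]C[1+k]≡[1+n]*nCk n k)
                                   ([1+k]*[1+n]C[1+k]≡[1+n]*nCk n (suc k))) ⟩
  A ℕ.+ (suc n ℕ.* (n C k) ℕ.+ suc n ℕ.* (n C suc k))
    ≡⟨ cong (A ℕ.+_) (ℕₚ.*-distribˡ-+ (suc n) (n C k) (n C suc k)) ⟨
  A ℕ.+ suc n ℕ.* (n C k ℕ.+ n C suc k)
    ≡⟨ cong (λ x → A ℕ.+ suc n ℕ.* x) (nCk+nC[k+1]≡[n+1]C[k+1] n k) ⟩
  (2 ℕ.+ n) ℕ.* A
    ∎
  where
  open ≡-Reasoning
  A = suc n C suc k
  B = suc n C suc (suc k)
  expand : ∀ k a b → (2 ℕ.+ k) ℕ.* (a ℕ.+ b) ≡ a ℕ.+ (suc k ℕ.* a ℕ.+ suc (suc k) ℕ.* b)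
  expand = ℕ-solve-∀

[m+n]Cn≡[m+n]Cm : ∀ m n → (m ℕ.+ n) C n ≡ (m ℕ.+ n) C m
[m+n]Cn≡[m+n]Cm m n = trans (nCk≡nC[n∸k] (ℕₚ.m≤n+m n m)) (cong ((m ℕ.+ n) C_) (ℕₚ.m+n∸n≡m m n))

[1+m]*[1+m+p]Cp≡[1+m+p]*[m+p]Cp : ∀ m p → suc m ℕ.* ((suc m + p) C p) ≡ suc (m + p) ℕ.* ((m + p) C p)
[1+m]*[1+m+p]Cp≡[1+m+p]*[m+p]Cp m p = begin
  suc m ℕ.* ((suc m + p) C p)       ≡⟨ cong (suc m ℕ.*_) ([m+n]Cn≡[m+n]Cm (suc m) p) ⟩
  suc m ℕ.* (suc (m + p) C suc m)   ≡⟨ [1+k]*[1+n]C[1+k]≡[1+n]*nCk (m + p) m ⟩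
  suc (m + p) ℕ.* ((m + p) C m)     ≡⟨ cong (suc (m + p) ℕ.*_) ([m+n]Cn≡[m+n]Cm m p) ⟨
  suc (m + p) ℕ.* ((m + p) C p)     ∎
  where open ≡-Reasoning

binomial-ratio : ∀ m p →
  ((+ suc m) / suc (m + p)) * fromℤ (+ ((suc m + p) C p)) ≡ fromℤ (+ ((m + p) C p))
binomial-ratio m p =
  /-*-fromℤ (+ suc m) (+ ((suc m + p) C p)) (+ ((m + p) C p)) (suc (m + p)) (begin
  + suc m ℤ.* + ((suc m + p) C p)         ≡⟨ ℤₚ.pos-* (suc m) ((suc m + p) C p) ⟨
  + (suc m ℕ.* ((suc m + p) C p))         ≡⟨ cong +_ ([1+m]*[1+m+p]Cp≡[1+m+p]*[m+p]Cp m p) ⟩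
  + (suc (m + p) ℕ.* ((m + p) C p))       ≡⟨ cong +_ (ℕₚ.*-comm (suc (m + p)) ((m + p) C p)) ⟩
  + (((m + p) C p) ℕ.* suc (m + p))       ≡⟨ ℤₚ.pos-* ((m + p) C p) (suc (m + p)) ⟩
  + ((m + p) C p) ℤ.* + suc (m + p)       ∎)
  where open ≡-Reasoning

binomial*invBinom≡1 : ∀ k p → fromℤ (+ ((k + p) C p)) * invBinom k p ≡ 1ℚ
binomial*invBinom≡1 k p = trans (ℚₚ.*-comm (fromℤ (+ ((k + p) C p))) (invBinom k p))
  (/-*-fromℤ (+ 1) (+ ((k + p) C p)) (+ 1) ((k + p) C p) {{ℕ.>-nonZero (binomPos k p)}} refl)

Z-recurrence : ∀ n m p →
  Z (suc n) m p ≡ ((+ (suc m)) / (suc (m + p))) * Z n (suc m) p +ℚ ((+ m) / 1) * Z n m p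
Z-recurrence n m p = begin
  Cₘ * stirling1Sum m (λ k → pBell (suc n + k) p)
    ≡⟨ cong (Cₘ *_) (stirling1Sum-cong m (λ k → cong (λ i → pBell i p) (sym (ℕₚ.+-suc n k)))) ⟩
  Cₘ * stirling1Sum m (λ k → B (suc k))
    ≡⟨ cong (Cₘ *_) (stirling1Sum-shift m B) ⟩
  Cₘ * (X +ℚ c * Y)
    ≡⟨ ℚₚ.*-distribˡ-+ Cₘ X (c * Y) ⟩
  Cₘ * X +ℚ Cₘ * (c * Y)
    ≡⟨ cong₂ _+ℚ_ (cong (_* X) (binomial-ratio m p)) (*-x∙yz≈y∙xz c Cₘ Y) ⟨
  (r * Cₘ₊₁) * X +ℚ c * (Cₘ * Y)
    ≡⟨ cong (_+ℚ c * (Cₘ * Y)) (ℚₚ.*-assoc r Cₘ₊₁ X) ⟩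
  r * (Cₘ₊₁ * X) +ℚ c * (Cₘ * Y)
    ∎
  where
  open ≡-Reasoning
  B : ℕ → ℚ
  B k = pBell (n + k) p
  Cₘ Cₘ₊₁ r c X Y : ℚ
  Cₘ   = fromℤ (+ ((m + p) C p))
  Cₘ₊₁ = fromℤ (+ ((suc m + p) C p))
  r    = (+ suc m) / suc (m + p)
  c    = fromℤ (+ m)
  X    = stirling1Sum (suc m) B
  Y    = stirling1Sum m B

Z[0,m,p]≡1 : ∀ m p → Z 0 m p ≡ 1ℚ
Z[0,m,p]≡1 m p =
  trans (cong (fromℤ (+ ((m + p) C p)) *_) (stirling-inversion m (λ j → invBinom j p)))
        (binomial*invBinom≡1 m p)

mainTheorem12 : ((n m p : ℕ) →
                    Z (suc n) m p
                      ≡ ((+ (suc m)) / (suc (m + p))) * Z n (suc m) p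
                        +ℚ ((+ m) / 1) * Z n m p)
                  × ((m p : ℕ) → Z 0 m p ≡ 1ℚ)
mainTheorem12 = Z-recurrence , Z[0,m,p]≡1
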